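{- Let $n,q\ge 1$. If $\mathcal{F}\subseteq\{0,1,\dots,q\}^n$ is $(q+1)$-sum intersecting, then $|\mathcal{F}|\le\left\lceil\frac{(q+1)^n}{2}\right\rceil$, and this bound is best possible.
   Context: Two vectors $\mathbf{x},\mathbf{y}\in\{0,1,\dots,q\}^n$ are $(q+1)$-sum intersecting if there is a coordinate $i$ with $x_i+y_i\ge q+1$; a family is $(q+1)$-sum intersecting if any two distinct members are $(q+1)$-sum intersecting. -}

module Defs where

open import Data.Nat using (ℕ; suc; _+_; _≥_)
open import Data.Fin using (Fin; toℕ)
open import Data.Vec using (Vec; lookup)
open import Data.List using (List)
open import Data.List.Membership.Propositional using (_∈_)
open import Data.Product using (∃-syntax)
open import Relation.Binary.PropositionalEquality using (_≢_)

Point : ℕ → ℕ → Set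
Point q n = Vec (Fin (suc q)) n

SumIntersecting : (q : ℕ) {n : ℕ} → Point q n → Point q n → Set
SumIntersecting q x y = ∃[ i ] toℕ (lookup x i) + toℕ (lookup y i) ≥ suc q

SumIntersectingFamily : (q : ℕ) {n : ℕ} → List (Point q n) → Set
SumIntersectingFamily q F =
  ∀ {x y} → x ∈ F → y ∈ F → x ≢ y → SumIntersecting q x y

-- The complement x ↦ (q − xᵢ)ᵢ is an involution of the cube, and x never sum-intersects
-- its complement, since every coordinate sum is exactly q. So a sum-intersecting family F
-- meets each orbit {x, complement x} at most once; the only singleton orbit is the centre
-- (q/2, …, q/2), which exists when q is even, hence 2|F| ≤ (q+1)^n + 1.
-- For sharpness take the points lexicographically at least their complement: this set
-- meets every orbit, and if two of its members x, y failed to sum-intersect then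
-- x ≤ complement y coordinatewise, so x ≤ complement y ≤ y lexicographically; symmetrically
-- y ≤ x, so x = y.
{-# OPTIONS --safe #-}
module Submission where

open import Defs
open import Data.Nat using (ℕ; zero; suc; _+_; _*_; _∸_; _^_; _≤_; _<_; _≤?_; z≤n; s≤s; ⌊_/2⌋; ⌈_/2⌉)
open import Data.Nat.Properties
  using (≤-antisym; +-comm; +-suc; +-monoʳ-≤; +-monoˡ-≤; <-irrefl; ≮⇒≥; m+[n∸m]≡n; m+n≤o⇒m≤o∸n;
         n≡⌊n+n/2⌋; n≡⌈n+n/2⌉; ⌊n/2⌋-mono; ⌈n/2⌉-mono; module ≤-Reasoning)
open import Data.Fin as Fin using (Fin; toℕ; opposite)
open import Data.Fin.Properties as Fin
  using (toℕ-injective; toℕ≤pred[n]; opposite-prop; opposite-involutive; any?)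
open import Data.Vec as Vec using (Vec; []; _∷_; lookup; tabulate)
open import Data.Vec.Properties
  using (∷-injective; ≡-dec; lookup-map; map-∘; map-cong; map-id; tabulate∘lookup; tabulate-cong)
open import Data.Vec.Relation.Binary.Pointwise.Inductive using (Pointwise-≡⇒≡)
import Data.Vec.Relation.Binary.Lex.NonStrict as Lex
open import Data.List using (List; []; _∷_; _++_; length; map; filter; cartesianProductWith; allFin)
open import Data.List.Properties using (length-++; length-map; filter-notAll; length-tabulate)
open import Data.List.Membership.Propositional using (_∈_)
open import Data.List.Membership.Propositional.Properties
  using (∈-filter⁺; ∈-filter⁻; ∈-map⁺; ∈-map⁻; ∈-++⁺ˡ; ∈-++⁺ʳ; ∈-cartesianProductWith⁺; ∈-allFin)
open import Data.List.Relation.Binary.Disjoint.Propositional using (Disjoint)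
open import Data.List.Relation.Unary.Unique.Propositional using (Unique)
import Data.List.Relation.Unary.Unique.Propositional.Properties as Unique
open import Data.List.Relation.Unary.All as All using (All)
open import Data.List.Relation.Unary.AllPairs using ([]; _∷_)
open import Data.List.Relation.Unary.Any as Any using (Any; here; there)
open import Data.Product using (_×_; _,_; proj₂; ∃-syntax)
open import Data.Sum using (_⊎_; inj₁; inj₂)
open import Data.Unit using (tt)
open import Data.Empty using (⊥-elim)
open import Function using (_∘_)
open import Relation.Nullary using (¬_; Dec; yes; no; ¬?)
open import Relation.Nullary.Decidable using (decidable-stable)
open import Relation.Binary using (Rel; DecidableEquality)
open import Relation.Binary.PropositionalEquality
  using (_≡_; refl; sym; trans; cong; cong₂; subst; module ≡-Reasoning)
open import Relation.Unary using (Pred; Decidable)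
open import Relation.Unary.Properties using (∁?)

module _ {A : Set} where

  unique-⊆⇒length-≤ : DecidableEquality A → {xs ys : List A} → Unique xs →
                      (∀ {z} → z ∈ xs → z ∈ ys) → length xs ≤ length ys
  unique-⊆⇒length-≤ _≟_ {[]}     _              _     = z≤n
  unique-⊆⇒length-≤ _≟_ {x ∷ xs} {ys} (x∉xs ∷ u) xs⊆ys =
    begin
      suc (length xs)                  ≤⟨ s≤s (unique-⊆⇒length-≤ _≟_ u xs⊆ys-x) ⟩
      suc (length (filter (x ≢?_) ys)) ≤⟨ filter-notAll (x ≢?_) ys x∈ys ⟩
      length ys                        ∎
    where
    open ≤-Reasoning
    _≢?_ : (u v : A) → Dec (¬ u ≡ v)
    u ≢? v = ¬? (u ≟ v)
    x∈ys : Any (λ y → ¬ ¬ x ≡ y) ys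
    x∈ys = Any.map (λ x≡y x≢y → x≢y x≡y) (xs⊆ys (here refl))
    xs⊆ys-x : ∀ {z} → z ∈ xs → z ∈ filter (x ≢?_) ys
    xs⊆ys-x z∈xs = ∈-filter⁺ (x ≢?_) (xs⊆ys (there z∈xs)) (All.lookup x∉xs z∈xs)

  length-filter+filter-∁ : ∀ {p} {P : Pred A p} (P? : Decidable P) xs →
                           length (filter P? xs) + length (filter (∁? P?) xs) ≡ length xs
  length-filter+filter-∁ P? []       = refl
  length-filter+filter-∁ P? (x ∷ xs) with P? x
  ... | yes _ = cong suc (length-filter+filter-∁ P? xs)
  ... | no  _ = trans (+-suc _ _) (cong suc (length-filter+filter-∁ P? xs))

  length-filter-subsingleton : ∀ {p} {P : Pred A p} (P? : Decidable P) →
                               (∀ {x y} → P x → P y → x ≡ y) →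
                               ∀ {xs} → Unique xs → length (filter P? xs) ≤ 1
  length-filter-subsingleton {P = P} P? P-unique {xs} u = go (filter P? xs) (Unique.filter⁺ P? u)
    (All.tabulate (λ x∈ → proj₂ (∈-filter⁻ P? {xs = xs} x∈)))
    where
    go : ∀ ys → Unique ys → All P ys → length ys ≤ 1
    go []           _                 _                     = z≤n
    go (_ ∷ [])     _                 _                     = s≤s z≤n
    go (x ∷ y ∷ _) ((x≢y All.∷ _) ∷ _) (Px All.∷ Py All.∷ _) = ⊥-elim (x≢y (P-unique Px Py))

length-++-map : ∀ {A B : Set} (xs : List B) (f : A → B) (ys : List A) →
                length (xs ++ map f ys) ≡ length xs + length ys
length-++-map xs f ys = trans (length-++ xs) (cong (length xs +_) (length-map f ys))

length-cartesianProductWith : ∀ {A B C : Set} (f : A → B → C) (xs : List A) (ys : List B) →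
                              length (cartesianProductWith f xs ys) ≡ length xs * length ys
length-cartesianProductWith f []       ys = refl
length-cartesianProductWith f (x ∷ xs) ys =
  trans (length-++ (map (f x) ys))
        (cong₂ _+_ (length-map (f x) ys) (length-cartesianProductWith f xs ys))

module _ {m : ℕ} where

  allVec : ∀ n → List (Vec (Fin m) n)
  allVec zero    = [] ∷ []
  allVec (suc n) = cartesianProductWith _∷_ (allFin m) (allVec n)

  length-allVec : ∀ n → length (allVec n) ≡ m ^ n
  length-allVec zero    = refl
  length-allVec (suc n) = trans (length-cartesianProductWith _∷_ (allFin m) (allVec n))
                                (cong₂ _*_ (length-tabulate {n = m} (λ i → i)) (length-allVec n))

  allVec-unique : ∀ n → Unique (allVec n)
  allVec-unique zero    = All.[] ∷ []
  allVec-unique (suc n) =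
    Unique.cartesianProductWith⁺ _∷_ ∷-injective (Unique.allFin⁺ m) (allVec-unique n)

  ∈-allVec : ∀ {n} (x : Vec (Fin m) n) → x ∈ allVec n
  ∈-allVec []      = here refl
  ∈-allVec (a ∷ x) = ∈-cartesianProductWith⁺ _∷_ (∈-allFin a) (∈-allVec x)

  _≤ₗ_ : ∀ {n} → Rel (Vec (Fin m) n) _
  _≤ₗ_ = Lex.Lex-≤ _≡_ (Fin._≤_ {m} {m})

  ≤ₗ-antisym : ∀ {n} {x y : Vec (Fin m) n} → x ≤ₗ y → y ≤ₗ x → x ≡ y
  ≤ₗ-antisym x≤y y≤x = Pointwise-≡⇒≡ (Lex.≤-antisym sym Fin.≤-antisym x≤y y≤x)

  ≤ₗ-trans : ∀ {n} {x y z : Vec (Fin m) n} → x ≤ₗ y → y ≤ₗ z → x ≤ₗ z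
  ≤ₗ-trans = Lex.≤-trans Fin.≤-isPartialOrder

  ≤ₗ-total : ∀ {n} (x y : Vec (Fin m) n) → x ≤ₗ y ⊎ y ≤ₗ x
  ≤ₗ-total = Lex.≤-total sym Fin._≟_ Fin.≤-antisym Fin.≤-total

  _≤ₗ?_ : ∀ {n} (x y : Vec (Fin m) n) → Dec (x ≤ₗ y)
  _≤ₗ?_ = Lex.≤-dec Fin._≟_ Fin._≤?_

  pointwise⇒≤ₗ : ∀ {n} {x y : Vec (Fin m) n} → (∀ i → lookup x i Fin.≤ lookup y i) → x ≤ₗ y
  pointwise⇒≤ₗ {x = []}    {[]}    _   = Lex.base tt
  pointwise⇒≤ₗ {x = a ∷ x} {b ∷ y} x≤y with a Fin.≟ b
  ... | yes a≡b = Lex.next a≡b (pointwise⇒≤ₗ (x≤y ∘ Fin.suc))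
  ... | no  a≢b = Lex.this (x≤y Fin.zero , a≢b) refl

m+m≡n+n⇒m≡n : ∀ {m n} → m + m ≡ n + n → m ≡ n
m+m≡n+n⇒m≡n {m} {n} eq = trans (n≡⌊n+n/2⌋ m) (trans (cong ⌊_/2⌋ eq) (sym (n≡⌊n+n/2⌋ n)))

module _ {q : ℕ} where

  toℕ+toℕ-opposite : (a : Fin (suc q)) → toℕ a + toℕ (opposite a) ≡ q
  toℕ+toℕ-opposite a = trans (cong (toℕ a +_) (opposite-prop a)) (m+[n∸m]≡n (toℕ≤pred[n] a))

  complement : ∀ {n} → Point q n → Point q n
  complement = Vec.map opposite

  lookup-complement : ∀ {n} (x : Point q n) i → toℕ (lookup x i) + toℕ (lookup (complement x) i) ≡ q
  lookup-complement x i = trans (cong (λ b → toℕ (lookup x i) + toℕ b) (lookup-map i opposite x))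
                                (toℕ+toℕ-opposite (lookup x i))

  complement-involutive : ∀ {n} (x : Point q n) → complement (complement x) ≡ x
  complement-involutive x =
    trans (sym (map-∘ opposite opposite x)) (trans (map-cong opposite-involutive x) (map-id x))

  complement-injective : ∀ {n} {x y : Point q n} → complement x ≡ complement y → x ≡ y
  complement-injective {x = x} {y} cx≡cy =
    trans (sym (complement-involutive x)) (trans (cong complement cx≡cy) (complement-involutive y))

  complement-fixed⇒double : ∀ {n} {x : Point q n} → complement x ≡ x →
                            ∀ i → toℕ (lookup x i) + toℕ (lookup x i) ≡ q
  complement-fixed⇒double {x = x} cx≡x i =
    subst (λ w → toℕ (lookup x i) + toℕ (lookup w i) ≡ q) cx≡x (lookup-complement x i)

  complement-fixed-unique : ∀ {n} {x y : Point q n} → complement x ≡ x → complement y ≡ y → x ≡ y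
  complement-fixed-unique {x = x} {y} cx≡x cy≡y = begin
    x                   ≡⟨ sym (tabulate∘lookup x) ⟩
    tabulate (lookup x) ≡⟨ tabulate-cong (λ i → toℕ-injective (m+m≡n+n⇒m≡n (same-double i))) ⟩
    tabulate (lookup y) ≡⟨ tabulate∘lookup y ⟩
    y                   ∎
    where
    open ≡-Reasoning
    same-double : ∀ i → toℕ (lookup x i) + toℕ (lookup x i) ≡ toℕ (lookup y i) + toℕ (lookup y i)
    same-double i = trans (complement-fixed⇒double cx≡x i) (sym (complement-fixed⇒double cy≡y i))

  sumIntersecting-sym : ∀ {n} (x y : Point q n) → SumIntersecting q x y → SumIntersecting q y x
  sumIntersecting-sym x y (i , sum≥) = i , subst (suc q ≤_) (+-comm (toℕ (lookup x i)) _) sum≥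

  sumIntersecting? : ∀ {n} (x y : Point q n) → Dec (SumIntersecting q x y)
  sumIntersecting? x y = any? (λ i → suc q ≤? toℕ (lookup x i) + toℕ (lookup y i))

  ¬sumIntersecting-complement : ∀ {n} (x : Point q n) → ¬ SumIntersecting q x (complement x)
  ¬sumIntersecting-complement x (i , sum≥) = <-irrefl refl (subst (q <_) (lookup-complement x i) sum≥)

  ¬sumIntersecting⇒≤complement : ∀ {n} (x y : Point q n) → ¬ SumIntersecting q x y →
                                 ∀ i → lookup x i Fin.≤ lookup (complement y) i
  ¬sumIntersecting⇒≤complement x y ¬si i =
    subst (toℕ (lookup x i) ≤_) (sym (toℕ-lookup-complement))
          (m+n≤o⇒m≤o∸n (toℕ (lookup x i)) (≮⇒≥ (λ sum> → ¬si (i , sum>))))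
    where
    toℕ-lookup-complement : toℕ (lookup (complement y) i) ≡ q ∸ toℕ (lookup y i)
    toℕ-lookup-complement = trans (cong toℕ (lookup-map i opposite y)) (opposite-prop (lookup y i))

  sumIntersectingFamily-complement-fixed : ∀ {n} {F : List (Point q n)} → SumIntersectingFamily q F →
                                           ∀ {x} → x ∈ F → complement x ∈ F → complement x ≡ x
  sumIntersectingFamily-complement-fixed si {x} x∈F cx∈F =
    decidable-stable (≡-dec Fin._≟_ (complement x) x)
      (λ cx≢x → ¬sumIntersecting-complement x
                  (sumIntersecting-sym (complement x) x (si cx∈F x∈F cx≢x)))

  sumIntersectingFamily-double-length≤ : ∀ {n} {F : List (Point q n)} → Unique F →
                                         SumIntersectingFamily q F → length F + length F ≤ suc (suc q ^ n)
  sumIntersectingFamily-double-length≤ {n} {F} u si = begin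
    length F + length F                      ≤⟨ +-monoʳ-≤ (length F) F≤1+moved ⟩
    length F + suc (length moved)            ≡⟨ +-suc (length F) (length moved) ⟩
    suc (length F + length moved)            ≡⟨ cong suc (sym (length-++-map F complement moved)) ⟩
    suc (length (F ++ map complement moved)) ≤⟨ s≤s (unique-⊆⇒length-≤ (≡-dec Fin._≟_) F++cmoved-unique
                                                                      (λ {z} _ → ∈-allVec z)) ⟩
    suc (length (allVec n))                  ≡⟨ cong suc (length-allVec n) ⟩
    suc (suc q ^ n)                          ∎
    where
    open ≤-Reasoning
    Fixed? : Decidable (λ (x : Point q n) → complement x ≡ x)
    Fixed? x = ≡-dec Fin._≟_ (complement x) x
    moved : List (Point q n)
    moved = filter (∁? Fixed?) F
    F≤1+moved : length F ≤ suc (length moved)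
    F≤1+moved = subst (_≤ suc (length moved)) (length-filter+filter-∁ Fixed? F)
      (+-monoˡ-≤ (length moved) (length-filter-subsingleton Fixed? complement-fixed-unique u))
    disjoint : Disjoint F (map complement moved)
    disjoint (z∈F , z∈cmoved) with ∈-map⁻ complement z∈cmoved
    ... | w , w∈moved , refl with ∈-filter⁻ (∁? Fixed?) {xs = F} w∈moved
    ... | w∈F , cw≢w = cw≢w (sumIntersectingFamily-complement-fixed si w∈F z∈F)
    F++cmoved-unique : Unique (F ++ map complement moved)
    F++cmoved-unique =
      Unique.++⁺ u (Unique.map⁺ complement-injective (Unique.filter⁺ (∁? Fixed?) u)) disjoint

  upperHalf : ∀ n → List (Point q n)
  upperHalf n = filter (λ x → complement x ≤ₗ? x) (allVec n)

  upperHalf-unique : ∀ n → Unique (upperHalf n)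
  upperHalf-unique n = Unique.filter⁺ (λ x → complement x ≤ₗ? x) (allVec-unique n)

  ∈-upperHalf⁻ : ∀ {n} {x : Point q n} → x ∈ upperHalf n → complement x ≤ₗ x
  ∈-upperHalf⁻ {n} = proj₂ ∘ ∈-filter⁻ (λ x → complement x ≤ₗ? x) {xs = allVec n}

  ∈-upperHalf⁺ : ∀ {n} {x : Point q n} → complement x ≤ₗ x → x ∈ upperHalf n
  ∈-upperHalf⁺ {x = x} = ∈-filter⁺ (λ x → complement x ≤ₗ? x) (∈-allVec x)

  ¬sumIntersecting⇒≤ₗ : ∀ {n} (x : Point q n) {y} → y ∈ upperHalf n →
                        ¬ SumIntersecting q x y → x ≤ₗ y
  ¬sumIntersecting⇒≤ₗ x {y} y∈ ¬si =
    ≤ₗ-trans (pointwise⇒≤ₗ (¬sumIntersecting⇒≤complement x y ¬si)) (∈-upperHalf⁻ y∈)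

  upperHalf-sumIntersecting : ∀ n → SumIntersectingFamily q (upperHalf n)
  upperHalf-sumIntersecting n {x} {y} x∈ y∈ x≢y =
    decidable-stable (sumIntersecting? x y) λ ¬si →
      x≢y (≤ₗ-antisym (¬sumIntersecting⇒≤ₗ x y∈ ¬si)
                      (¬sumIntersecting⇒≤ₗ y x∈ (¬si ∘ sumIntersecting-sym y x)))

  allVec⊆upperHalf++complement : ∀ {n} (z : Point q n) → z ∈ upperHalf n ++ map complement (upperHalf n)
  allVec⊆upperHalf++complement {n} z with ≤ₗ-total (complement z) z
  ... | inj₁ cz≤z = ∈-++⁺ˡ (∈-upperHalf⁺ cz≤z)
  ... | inj₂ z≤cz = ∈-++⁺ʳ (upperHalf n) (subst (_∈ map complement (upperHalf n)) ccz≡z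
                                          (∈-map⁺ complement (∈-upperHalf⁺ ccz≤cz)))
    where
    ccz≡z : complement (complement z) ≡ z
    ccz≡z = complement-involutive z
    ccz≤cz : complement (complement z) ≤ₗ complement z
    ccz≤cz = subst (_≤ₗ complement z) (sym ccz≡z) z≤cz

  cube≤double-upperHalf : ∀ n → suc q ^ n ≤ length (upperHalf n) + length (upperHalf n)
  cube≤double-upperHalf n = begin
    suc q ^ n                                            ≡⟨ sym (length-allVec n) ⟩
    length (allVec n)                                    ≤⟨ unique-⊆⇒length-≤ (≡-dec Fin._≟_) (allVec-unique n)
                                                              (λ {z} _ → allVec⊆upperHalf++complement z) ⟩
    length (upperHalf n ++ map complement (upperHalf n)) ≡⟨ length-++-map (upperHalf n) complement (upperHalf n) ⟩
    length (upperHalf n) + length (upperHalf n)          ∎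
    where open ≤-Reasoning

m+m≤1+n⇒m≤⌈n/2⌉ : ∀ m n → m + m ≤ suc n → m ≤ ⌈ n /2⌉
m+m≤1+n⇒m≤⌈n/2⌉ m n le = subst (_≤ ⌈ n /2⌉) (sym (n≡⌊n+n/2⌋ m)) (⌊n/2⌋-mono le)

n≤m+m⇒⌈n/2⌉≤m : ∀ m n → n ≤ m + m → ⌈ n /2⌉ ≤ m
n≤m+m⇒⌈n/2⌉≤m m n le = subst (⌈ n /2⌉ ≤_) (sym (n≡⌈n+n/2⌉ m)) (⌈n/2⌉-mono le)

proposition2p1 : (n q : ℕ) → 1 ≤ n → 1 ≤ q →
    ((F : List (Point q n)) → Unique F → SumIntersectingFamily q F →
      length F ≤ ⌈ suc q ^ n /2⌉)
    × (∃[ F ] (Unique {A = Point q n} F × SumIntersectingFamily q F × length F ≡ ⌈ suc q ^ n /2⌉))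
proposition2p1 n q _ _ = upper-bound , upperHalf n , upperHalf-unique n , upperHalf-sumIntersecting n , size
  where
  upper-bound : (F : List (Point q n)) → Unique F → SumIntersectingFamily q F →
                length F ≤ ⌈ suc q ^ n /2⌉
  upper-bound F u si =
    m+m≤1+n⇒m≤⌈n/2⌉ (length F) (suc q ^ n) (sumIntersectingFamily-double-length≤ u si)
  size : length (upperHalf n) ≡ ⌈ suc q ^ n /2⌉
  size = ≤-antisym (upper-bound (upperHalf n) (upperHalf-unique n) (upperHalf-sumIntersecting n))
                   (n≤m+m⇒⌈n/2⌉≤m (length (upperHalf n)) (suc q ^ n) (cube≤double-upperHalf n))
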